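{- Let $\ell\ge1$, $0\le k\le\ell$, $B=(b_1,\ldots,b_\ell)$ with integers $b_i\ge2$, let $v'\in\Gamma_B$ and $n=|\overline G_{v'}|$. Then $$\|\mathbf{x}^{\ell,k,n}_{v'}\|^2=S_{\ell-k}(B(G_{v'}))\prod_{i\in\overline G_{v'}}(v'_i+{v'_i}^2)\prod_{i\in G_{v'}}b_i.$$
   Context: For an integer $b\ge2$ let $\Sigma_b=\{0,\ldots,b-1\}$, $\Delta_b=\Sigma_b\cup\{g\}$ with $g$ a gap symbol, $\Gamma_b=\Delta_b\setminus\{0\}$; $\Delta_B,\Gamma_B$ are the products over $b_1,\ldots,b_\ell$, elements written as words $v_1\cdots v_\ell$. For $v\in\Delta_B$, $G_v=\{i: v_i=g\}$, $\overline G_v=[\ell]\setminus G_v$. $V_{\ell,k;B}=\{v\in\Delta_B:|G_v|=\ell-k\}$ and $V'_{\ell,n;B}=\{v\in\Gamma_B:|G_v|=\ell-n\}$. For $X=\{x_1<\cdots<x_m\}\subseteq[\ell]$, $B(X)=(b_{x_1},\ldots,b_{x_m})$; $S_i$ is the $i$-th elementary symmetric polynomial ($S_0=1$, $S_i=0$ if $i$ exceeds the number of variables). On $\Delta_{b_i}$ use the order $0\prec1\prec\cdots\prec b_i-1\prec g$, and set $\nu_i(x,y)=-b_i$ if $x=y=g$; $-y$ if $x=y\ne g$; $1$ if $x\prec y$; $0$ if $y\prec x$; $\nu_B(x,y)=\prod_i\nu_i(x_i,y_i)$. For $v'\in V'_{\ell,n;B}$, $\mathbf x^{\ell,k,n}_{v'}$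 is the real vector indexed by $V_{\ell,k;B}$ with entries $\mathbf x^{\ell,k,n}_{v'}(w)=(-1)^{\ell-k}\nu_B(w,v')$. -}

module Defs where

open import Data.Nat as ℕ using (ℕ; zero; suc)
open import Data.Fin using (Fin; zero; suc; toℕ)
open import Data.Fin.Properties using (_≟_)
open import Data.Integer as ℤ using (ℤ; +_; -_)
open import Data.List using (List; []; _∷_; map; concatMap; foldr; filter; length; allFin)
open import Data.Bool using (Bool; true; false)
open import Relation.Nullary using (Dec; yes; no; does)
open import Relation.Binary.PropositionalEquality using (_≡_)

data Sym (b : ℕ) : Set where
  dig : Fin b → Sym b
  gap : Sym b

Word : (ℓ : ℕ) → (Fin ℓ → ℕ) → Set
Word ℓ B = (i : Fin ℓ) → Sym (B i)

isGap : ∀ {b} → Sym b → Bool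
isGap (dig _) = false
isGap gap     = true

-- Γ_b membership: symbol is not the digit 0
isZeroDigit : ∀ {b} → Sym b → Bool
isZeroDigit (dig x) = does (toℕ x ℕ.≟ 0)
isZeroDigit gap     = false

gapCount : ∀ {ℓ B} → Word ℓ B → ℕ
gapCount {ℓ} v = length (filter (λ i → isGap (v i) Data.Bool.≟ true) (allFin ℓ))
  where import Data.Bool

allSym : (b : ℕ) → List (Sym b)
allSym b = gap ∷ map dig (allFin b)

consW : ∀ {ℓ} {B : Fin (suc ℓ) → ℕ} → Sym (B zero) → Word ℓ (λ i → B (suc i)) → Word (suc ℓ) B
consW s w zero    = s
consW s w (suc i) = w i

allWords : (ℓ : ℕ) (B : Fin ℓ → ℕ) → List (Word ℓ B)
allWords zero    B = (λ ()) ∷ []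
allWords (suc ℓ) B =
  concatMap (λ s → map (consW {ℓ} {B} s) (allWords ℓ (λ i → B (suc i)))) (allSym (B zero))

V : (ℓ k : ℕ) (B : Fin ℓ → ℕ) → List (Word ℓ B)
V ℓ k B = filter (λ w → gapCount w ℕ.≟ (ℓ ℕ.∸ k)) (allWords ℓ B)

-- ν_i on Δ_{b_i}, order 0 ≺ 1 ≺ ⋯ ≺ b-1 ≺ g
ν : (b : ℕ) → Sym b → Sym b → ℤ
ν b gap     gap     = - (+ b)
ν b (dig x) gap     = + 1
ν b gap     (dig y) = + 0
ν b (dig x) (dig y) with toℕ x ℕ.<? toℕ y
... | yes _ = + 1
... | no _ with toℕ x ℕ.≟ toℕ y
...   | yes _ = - (+ toℕ y)
...   | no _  = + 0

sumℤ : List ℤ → ℤ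
sumℤ = foldr ℤ._+_ (+ 0)

prodℤ : List ℤ → ℤ
prodℤ = foldr ℤ._*_ (+ 1)

prodℕ : List ℕ → ℕ
prodℕ = foldr ℕ._*_ 1

νB : ∀ {ℓ} (B : Fin ℓ → ℕ) → Word ℓ B → Word ℓ B → ℤ
νB {ℓ} B x y = prodℤ (map (λ i → ν (B i) (x i) (y i)) (allFin ℓ))

signPow : ℕ → ℤ
signPow zero    = + 1
signPow (suc m) = - (signPow m)

xEntry : (ℓ k : ℕ) (B : Fin ℓ → ℕ) → Word ℓ B → Word ℓ B → ℤ
xEntry ℓ k B v' w = signPow (ℓ ℕ.∸ k) ℤ.* νB B w v'

normSq : (ℓ k : ℕ) (B : Fin ℓ → ℕ) → Word ℓ B → ℤ
normSq ℓ k B v' = sumℤ (map (λ w → xEntry ℓ k B v' w ℤ.* xEntry ℓ k B v' w) (V ℓ k B))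

esym : ℕ → List ℕ → ℕ
esym zero    _        = 1
esym (suc i) []       = 0
esym (suc i) (x ∷ xs) = x ℕ.* esym i xs ℕ.+ esym (suc i) xs

gapSet : ∀ {ℓ B} → Word ℓ B → List (Fin ℓ)
gapSet {ℓ} v = filter (λ i → isGap (v i) Data.Bool.≟ true) (allFin ℓ)
  where import Data.Bool

nonGapSet : ∀ {ℓ B} → Word ℓ B → List (Fin ℓ)
nonGapSet {ℓ} v = filter (λ i → isGap (v i) Data.Bool.≟ false) (allFin ℓ)
  where import Data.Bool

-- numeric value of a non-gap symbol (0 for the gap; only used on non-gap positions)
val : ∀ {b} → Sym b → ℕ
val (dig x) = toℕ x
val gap     = 0

{-# OPTIONS --safe #-}
-- Squaring removes the sign (-1)^(ℓ-k), so ‖x‖² is the sum of ν_B(w,v')² over the words w with exactly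
-- ℓ - k gaps. That square is a product over positions, so the sum over all of Δ_B, graded by the number
-- of gaps, factorises: position i contributes Σ_x ν_i(x,v'_i)² t^[x = g], which is y + y² when v'_i = y
-- is a digit (the y digits below y give 1 each, y itself gives y², the gap gives 0) and b_i + b_i² t when
-- v'_i = g. The coefficient of t^(ℓ-k) in Π_{i ∈ G}(b_i + b_i² t) is S_{ℓ-k}(B(G)) Π_{i ∈ G} b_i.
module Submission where

open import Defs
open import Data.Nat using (ℕ; _≤_; _∸_; _*_; _+_)
open import Data.Fin using (Fin)
open import Data.List using (map)
open import Data.Bool using (false)
open import Data.Integer using (+_)
open import Relation.Binary.PropositionalEquality using (_≡_)

open import Data.Nat using (zero; suc; _<_; _<?_; _≟_; z≤n; s≤s)
open import Data.Nat.ListAction using (sum; product)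
open import Data.Nat.ListAction.Properties using (sum-++)
open import Data.Nat.Properties using (+-identityʳ; *-zeroʳ; *-distribˡ-+; *-distribʳ-+; <⇒≢; <⇒≤)
open import Data.Nat.Tactic.RingSolver using (solve-∀)
open import Data.Fin using (zero; suc; toℕ)
open import Data.Fin.Properties using (toℕ<n)
open import Data.Integer as ℤ using (ℤ; ∣_∣; -[1+_])
open import Data.Integer.Properties using (pos-+; pos-*; abs-*; ∣-i∣≡∣i∣)
open import Data.List using (List; []; _∷_; _++_; filter; concatMap; tabulate; allFin; length)
import Data.List.Properties as List
open import Data.Bool using (Bool; true; if_then_else_)
open import Data.Bool.Properties using (not-¬) renaming (_≟_ to _≟ᴮ_)
open import Function using (_∘_; id)
open import Level using (Level)
open import Relation.Nullary using (does; yes; no; ¬_)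
open import Relation.Nullary.Decidable using (dec-true; dec-false)
open import Relation.Unary using (Pred; Decidable)
open import Relation.Binary.PropositionalEquality using (refl; sym; trans; cong; cong₂)
open Relation.Binary.PropositionalEquality.≡-Reasoning

private
  variable
    p : Level
    A C : Set

sum-map-+ : (f g : A → ℕ) (xs : List A) →
            sum (map (λ x → f x + g x) xs) ≡ sum (map f xs) + sum (map g xs)
sum-map-+ f g []       = refl
sum-map-+ f g (x ∷ xs) = trans (cong (_+_ (f x + g x)) (sum-map-+ f g xs)) (interchange (f x) (g x) _ _)
  where
  interchange : ∀ a b c d → a + b + (c + d) ≡ a + c + (b + d)
  interchange = solve-∀

sum-map-*ˡ : (c : ℕ) (f : A → ℕ) (xs : List A) → sum (map (λ x → c * f x) xs) ≡ c * sum (map f xs)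
sum-map-*ˡ c f []       = sym (*-zeroʳ c)
sum-map-*ˡ c f (x ∷ xs) = trans (cong (_+_ (c * f x)) (sum-map-*ˡ c f xs)) (sym (*-distribˡ-+ c (f x) _))

sum-map-*ʳ : (c : ℕ) (f : A → ℕ) (xs : List A) → sum (map (λ x → f x * c) xs) ≡ sum (map f xs) * c
sum-map-*ʳ c f []       = refl
sum-map-*ʳ c f (x ∷ xs) = trans (cong (_+_ (f x * c)) (sum-map-*ʳ c f xs)) (sym (*-distribʳ-+ c (f x) _))

sum-map-zero : (xs : List A) → sum (map (λ _ → 0) xs) ≡ 0
sum-map-zero []       = refl
sum-map-zero (x ∷ xs) = sum-map-zero xs

sum-map-one : (xs : List A) → sum (map (λ _ → 1) xs) ≡ length xs
sum-map-one []       = refl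
sum-map-one (x ∷ xs) = cong suc (sum-map-one xs)

sum-concatMap : (φ : C → ℕ) (f : A → List C) (xs : List A) →
                sum (map φ (concatMap f xs)) ≡ sum (map (λ x → sum (map φ (f x))) xs)
sum-concatMap φ f []       = refl
sum-concatMap φ f (x ∷ xs) = begin
  sum (map φ (f x ++ concatMap f xs))
    ≡⟨ cong sum (List.map-++ φ (f x) _) ⟩
  sum (map φ (f x) ++ map φ (concatMap f xs))
    ≡⟨ sum-++ (map φ (f x)) _ ⟩
  sum (map φ (f x)) + sum (map φ (concatMap f xs))
    ≡⟨ cong (_+_ (sum (map φ (f x)))) (sum-concatMap φ f xs) ⟩
  sum (map φ (f x)) + sum (map (λ y → sum (map φ (f y))) xs) ∎

sum-filter : {P : Pred A p} (P? : Decidable P) (f : A → ℕ) (xs : List A) →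
             sum (map f (filter P? xs)) ≡ sum (map (λ x → if does (P? x) then f x else 0) xs)
sum-filter P? f []       = refl
sum-filter P? f (x ∷ xs) with does (P? x)
... | true  = cong (_+_ (f x)) (sum-filter P? f xs)
... | false = sum-filter P? f xs

sumℤ-map-pos : (f : A → ℕ) (xs : List A) → sumℤ (map (λ x → + f x) xs) ≡ + sum (map f xs)
sumℤ-map-pos f []       = refl
sumℤ-map-pos f (x ∷ xs) = trans (cong (ℤ._+_ (+ f x)) (sumℤ-map-pos f xs)) (sym (pos-+ (f x) _))

if-*ˡ : ∀ c (x y : ℕ) → (if c then x * y else 0) ≡ x * (if c then y else 0)
if-*ˡ true  x y = refl
if-*ˡ false x y = sym (*-zeroʳ x)

filter-map : {P : Pred C p} (f : A → C) (P? : Decidable P) (xs : List A) →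
             filter P? (map f xs) ≡ map f (filter (P? ∘ f) xs)
filter-map f P? []       = refl
filter-map f P? (x ∷ xs) with does (P? (f x))
... | true  = cong (f x ∷_) (filter-map f P? xs)
... | false = filter-map f P? xs

allFin-suc : ∀ n → allFin (suc n) ≡ zero ∷ map suc (allFin n)
allFin-suc n = cong (zero ∷_) (sym (List.map-tabulate id suc))

module _ {n} {P : Pred (Fin (suc n)) p} (P? : Decidable P) where

  filter-allFin-accept : P zero → filter P? (allFin (suc n)) ≡ zero ∷ map suc (filter (P? ∘ suc) (allFin n))
  filter-allFin-accept P0 = begin
    filter P? (allFin (suc n))                 ≡⟨ cong (filter P?) (allFin-suc n) ⟩
    filter P? (zero ∷ map suc (allFin n))      ≡⟨ List.filter-accept P? P0 ⟩
    zero ∷ filter P? (map suc (allFin n))      ≡⟨ cong (zero ∷_) (filter-map suc P? (allFin n)) ⟩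
    zero ∷ map suc (filter (P? ∘ suc) (allFin n)) ∎

  filter-allFin-reject : ¬ P zero → filter P? (allFin (suc n)) ≡ map suc (filter (P? ∘ suc) (allFin n))
  filter-allFin-reject ¬P0 = begin
    filter P? (allFin (suc n))                 ≡⟨ cong (filter P?) (allFin-suc n) ⟩
    filter P? (zero ∷ map suc (allFin n))      ≡⟨ List.filter-reject P? ¬P0 ⟩
    filter P? (map suc (allFin n))             ≡⟨ filter-map suc P? (allFin n) ⟩
    map suc (filter (P? ∘ suc) (allFin n))     ∎

gapBit : ∀ {b} → Sym b → ℕ
gapBit gap     = 1
gapBit (dig _) = 0

isGapAt? : ∀ {ℓ B} (v : Word ℓ B) (c : Bool) → Decidable (λ i → isGap (v i) ≡ c)
isGapAt? v c i = isGap (v i) ≟ᴮ c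

gapCount-consW : ∀ {ℓ} {B : Fin (suc ℓ) → ℕ} (s : Sym (B zero)) (w : Word ℓ (B ∘ suc)) →
                 gapCount (consW {ℓ} {B} s w) ≡ gapBit s + gapCount w
gapCount-consW {ℓ} {B} gap w =
  trans (cong length (filter-allFin-accept (isGapAt? (consW {ℓ} {B} gap w) true) refl))
        (cong suc (List.length-map suc (gapSet w)))
gapCount-consW {ℓ} {B} (dig d) w =
  trans (cong length (filter-allFin-reject (isGapAt? (consW {ℓ} {B} (dig d) w) true) (λ ())))
        (List.length-map suc (gapSet w))

gapBases : ∀ {ℓ B} → Word ℓ B → List ℕ
gapBases {B = B} v = map B (gapSet v)

digitFactors : ∀ {ℓ B} → Word ℓ B → List ℕ
digitFactors v = map (λ i → val (v i) + val (v i) * val (v i)) (nonGapSet v)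

module _ {ℓ} {B : Fin (suc ℓ) → ℕ} (v : Word (suc ℓ) B) where

  gapBases-gap : v zero ≡ gap → gapBases v ≡ B zero ∷ gapBases (v ∘ suc)
  gapBases-gap eq =
    trans (cong (map B) (filter-allFin-accept (isGapAt? v true) (cong isGap eq)))
          (cong (B zero ∷_) (sym (List.map-∘ (gapSet (v ∘ suc)))))

  gapBases-dig : ∀ {y} → v zero ≡ dig y → gapBases v ≡ gapBases (v ∘ suc)
  gapBases-dig eq =
    trans (cong (map B) (filter-allFin-reject (isGapAt? v true) (not-¬ (cong isGap eq))))
          (sym (List.map-∘ (gapSet (v ∘ suc))))

  digitFactors-gap : v zero ≡ gap → digitFactors v ≡ digitFactors (v ∘ suc)
  digitFactors-gap eq =
    trans (cong (map _) (filter-allFin-reject (isGapAt? v false) (not-¬ (cong isGap eq))))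
          (sym (List.map-∘ (nonGapSet (v ∘ suc))))

  digitFactors-dig : ∀ {y} → v zero ≡ dig y → digitFactors v ≡ (toℕ y + toℕ y * toℕ y) ∷ digitFactors (v ∘ suc)
  digitFactors-dig eq =
    trans (cong (map _) (filter-allFin-accept (isGapAt? v false) (cong isGap eq)))
          (cong₂ _∷_ (cong (λ s → val s + val s * val s) eq) (sym (List.map-∘ (nonGapSet (v ∘ suc)))))

νB-head : ∀ {ℓ} (B : Fin (suc ℓ) → ℕ) (w v : Word (suc ℓ) B) →
          νB B w v ≡ ν (B zero) (w zero) (v zero) ℤ.* νB (B ∘ suc) (w ∘ suc) (v ∘ suc)
νB-head B w v = cong (ℤ._*_ (f zero))
  (cong prodℤ (trans (List.map-tabulate suc f) (sym (List.map-tabulate id (f ∘ suc)))))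
  where f = λ i → ν (B i) (w i) (v i)

∣_∣² : ℤ → ℕ
∣ i ∣² = ∣ i ∣ * ∣ i ∣

i*i≡+∣i∣² : ∀ i → i ℤ.* i ≡ + ∣ i ∣²
i*i≡+∣i∣² (+ n)    = sym (pos-* n n)
i*i≡+∣i∣² -[1+ n ] = refl

∣i*j∣²≡∣i∣²*∣j∣² : ∀ i j → ∣ i ℤ.* j ∣² ≡ ∣ i ∣² * ∣ j ∣²
∣i*j∣²≡∣i∣²*∣j∣² i j = trans (cong (λ n → n * n) (abs-* i j)) (square-* ∣ i ∣ ∣ j ∣)
  where
  square-* : ∀ m n → m * n * (m * n) ≡ m * m * (n * n)
  square-* = solve-∀

∣signPow∣≡1 : ∀ m → ∣ signPow m ∣ ≡ 1
∣signPow∣≡1 zero    = refl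
∣signPow∣≡1 (suc m) = trans (∣-i∣≡∣i∣ (signPow m)) (∣signPow∣≡1 m)

xEntry-square : ∀ ℓ k (B : Fin ℓ → ℕ) (v w : Word ℓ B) → xEntry ℓ k B v w ℤ.* xEntry ℓ k B v w ≡ + ∣ νB B w v ∣²
xEntry-square ℓ k B v w = trans (i*i≡+∣i∣² (xEntry ℓ k B v w)) (cong (λ n → + (n * n)) ∣xEntry∣≡∣νB∣)
  where
  ∣xEntry∣≡∣νB∣ : ∣ xEntry ℓ k B v w ∣ ≡ ∣ νB B w v ∣
  ∣xEntry∣≡∣νB∣ = trans (abs-* (signPow (ℓ ∸ k)) (νB B w v))
                        (trans (cong (_* ∣ νB B w v ∣) (∣signPow∣≡1 (ℓ ∸ k))) (+-identityʳ _))

count-below : ∀ n m → m ≤ n → sum (tabulate {n = n} (λ i → if does (toℕ i <? m) then 1 else 0)) ≡ m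
count-below zero    zero    z≤n       = refl
count-below (suc n) zero    z≤n       = count-below n zero z≤n
count-below (suc n) (suc m) (s≤s m≤n) = cong suc (count-below n m m≤n)

count-at : ∀ n m c → m < n → sum (tabulate {n = n} (λ i → if does (toℕ i ≟ m) then c else 0)) ≡ c
count-at (suc n) zero    c _         = trans (cong (_+_ c) zeros) (+-identityʳ c)
  where
  zeros : sum (tabulate {n = n} (λ _ → 0)) ≡ 0
  zeros = trans (cong sum (sym (List.map-tabulate {n = n} id (λ _ → 0)))) (sum-map-zero (allFin n))
count-at (suc n) (suc m) c (s≤s m<n) = count-at n m c m<n

digitColumn : (b : ℕ) → Sym b → ℕ
digitColumn b s = sum (map (λ d → ∣ ν b (dig d) s ∣²) (allFin b))

digitColumn-gap : ∀ b → digitColumn b gap ≡ b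
digitColumn-gap b = trans (sum-map-one (allFin b)) (List.length-tabulate id)

digitSquare : ℕ → Bool → Bool → ℕ
digitSquare y below at = (if below then 1 else 0) + (if at then y * y else 0)

∣ν-dig-dig∣² : ∀ b (x y : Fin b) →
               ∣ ν b (dig x) (dig y) ∣² ≡ digitSquare (toℕ y) (does (toℕ x <? toℕ y)) (does (toℕ x ≟ toℕ y))
∣ν-dig-dig∣² b x y with toℕ x <? toℕ y
... | yes x<y = cong₂ (digitSquare (toℕ y)) (sym (dec-true (toℕ x <? toℕ y) x<y))
                                            (sym (dec-false (toℕ x ≟ toℕ y) (<⇒≢ x<y)))
... | no x≮y with toℕ x ≟ toℕ y
...   | yes x≡y = trans (cong (λ n → n * n) (∣-i∣≡∣i∣ (+ toℕ y)))
                        (cong₂ (digitSquare (toℕ y)) (sym (dec-false (toℕ x <? toℕ y) x≮y))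
                                                     (sym (dec-true (toℕ x ≟ toℕ y) x≡y)))
...   | no x≢y  = cong₂ (digitSquare (toℕ y)) (sym (dec-false (toℕ x <? toℕ y) x≮y))
                                              (sym (dec-false (toℕ x ≟ toℕ y) x≢y))

digitColumn-dig : ∀ b (y : Fin b) → digitColumn b (dig y) ≡ toℕ y + toℕ y * toℕ y
digitColumn-dig b y = begin
  sum (map (λ d → ∣ ν b (dig d) (dig y) ∣²) (allFin b))
    ≡⟨ cong sum (List.map-cong (λ d → ∣ν-dig-dig∣² b d y) (allFin b)) ⟩
  sum (map (λ d → below d + at d) (allFin b))
    ≡⟨ sum-map-+ below at (allFin b) ⟩
  sum (map below (allFin b)) + sum (map at (allFin b))
    ≡⟨ cong₂ _+_ (cong sum (List.map-tabulate id below)) (cong sum (List.map-tabulate id at)) ⟩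
  sum (tabulate below) + sum (tabulate at)
    ≡⟨ cong₂ _+_ (count-below b (toℕ y) (<⇒≤ (toℕ<n y))) (count-at b (toℕ y) _ (toℕ<n y)) ⟩
  toℕ y + toℕ y * toℕ y ∎
  where
  below at : Fin b → ℕ
  below d = if does (toℕ d <? toℕ y) then 1 else 0
  at d = if does (toℕ d ≟ toℕ y) then toℕ y * toℕ y else 0

gradedWeight : ∀ ℓ (B : Fin ℓ → ℕ) → Word ℓ B → ℕ → ℕ
gradedWeight ℓ B v m = sum (map (λ w → ∣ νB B w v ∣²) (filter (λ w → gapCount w ≟ m) (allWords ℓ B)))

normSq≡gradedWeight : ∀ ℓ k (B : Fin ℓ → ℕ) (v : Word ℓ B) → normSq ℓ k B v ≡ + gradedWeight ℓ B v (ℓ ∸ k)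
normSq≡gradedWeight ℓ k B v =
  trans (cong sumℤ (List.map-cong (xEntry-square ℓ k B v) (V ℓ k B)))
        (sumℤ-map-pos (λ w → ∣ νB B w v ∣²) (V ℓ k B))

module _ {ℓ} (B : Fin (suc ℓ) → ℕ) (v : Word (suc ℓ) B) where
  private
    b = B zero
    W = allWords ℓ (B ∘ suc)
    G = gradedWeight ℓ (B ∘ suc) (v ∘ suc)

    tailWeight : ℕ → ℕ → ℕ
    tailWeight o m = sum (map (λ w → if does (o + gapCount w ≟ m) then ∣ νB (B ∘ suc) w (v ∘ suc) ∣² else 0) W)

    tailWeight-0 : ∀ m → tailWeight 0 m ≡ gradedWeight ℓ (B ∘ suc) (v ∘ suc) m
    tailWeight-0 m = sym (sum-filter (λ w → gapCount w ≟ m) (λ w → ∣ νB (B ∘ suc) w (v ∘ suc) ∣²) W)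

    gradedWeight-split : ∀ m → gradedWeight (suc ℓ) B v m ≡
                         ∣ ν b gap (v zero) ∣² * tailWeight 1 m + digitColumn b (v zero) * tailWeight 0 m
    gradedWeight-split m = begin
      gradedWeight (suc ℓ) B v m
        ≡⟨ sum-filter (λ w → gapCount w ≟ m) (λ w → ∣ νB B w v ∣²) (allWords (suc ℓ) B) ⟩
      sum (map φ (concatMap (λ s → map (consW s) W) (allSym b)))
        ≡⟨ sum-concatMap φ (λ s → map (consW s) W) (allSym b) ⟩
      sum (map (λ s → sum (map φ (map (consW s) W))) (allSym b))
        ≡⟨ cong sum (List.map-cong firstSymbol (allSym b)) ⟩
      sum (map (λ s → ∣ ν b s (v zero) ∣² * tailWeight (gapBit s) m) (gap ∷ map dig (allFin b)))
        ≡⟨ cong (_+_ (∣ ν b gap (v zero) ∣² * tailWeight 1 m)) digits ⟩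
      ∣ ν b gap (v zero) ∣² * tailWeight 1 m + digitColumn b (v zero) * tailWeight 0 m ∎
      where
      φ : Word (suc ℓ) B → ℕ
      φ w = if does (gapCount w ≟ m) then ∣ νB B w v ∣² else 0

      φ-consW : ∀ s w → φ (consW {ℓ} {B} s w) ≡
                ∣ ν b s (v zero) ∣² * (if does (gapBit s + gapCount w ≟ m) then ∣ νB (B ∘ suc) w (v ∘ suc) ∣² else 0)
      φ-consW s w = trans
        (cong₂ (λ c x → if does (c ≟ m) then x else 0) (gapCount-consW {ℓ} {B} s w)
               (trans (cong ∣_∣² (νB-head B (consW {ℓ} {B} s w) v)) (∣i*j∣²≡∣i∣²*∣j∣² head tail)))
        (if-*ˡ (does (gapBit s + gapCount w ≟ m)) ∣ head ∣² ∣ tail ∣²)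
        where
        head = ν b s (v zero)
        tail = νB (B ∘ suc) w (v ∘ suc)

      firstSymbol : ∀ s → sum (map φ (map (consW s) W)) ≡ ∣ ν b s (v zero) ∣² * tailWeight (gapBit s) m
      firstSymbol s = trans (cong sum (sym (List.map-∘ W)))
                            (trans (cong sum (List.map-cong (φ-consW s) W)) (sum-map-*ˡ ∣ ν b s (v zero) ∣² _ W))

      digits : sum (map (λ s → ∣ ν b s (v zero) ∣² * tailWeight (gapBit s) m) (map dig (allFin b)))
               ≡ digitColumn b (v zero) * tailWeight 0 m
      digits = trans (cong sum (sym (List.map-∘ (allFin b))))
                     (sum-map-*ʳ (tailWeight 0 m) (λ d → ∣ ν b (dig d) (v zero) ∣²) (allFin b))

    gradedWeight-suc-zero : gradedWeight (suc ℓ) B v 0 ≡ digitColumn b (v zero) * G 0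
    gradedWeight-suc-zero = begin
      gradedWeight (suc ℓ) B v 0
        ≡⟨ gradedWeight-split 0 ⟩
      ∣ ν b gap (v zero) ∣² * tailWeight 1 0 + digitColumn b (v zero) * tailWeight 0 0
        ≡⟨ cong₂ _+_ (trans (cong (∣ ν b gap (v zero) ∣² *_) (sum-map-zero W)) (*-zeroʳ ∣ ν b gap (v zero) ∣²))
                     (cong (digitColumn b (v zero) *_) (tailWeight-0 0)) ⟩
      digitColumn b (v zero) * G 0 ∎

    gradedWeight-suc-suc : ∀ m → gradedWeight (suc ℓ) B v (suc m) ≡
                           ∣ ν b gap (v zero) ∣² * G m + digitColumn b (v zero) * G (suc m)
    gradedWeight-suc-suc m =
      trans (gradedWeight-split (suc m))
            (cong₂ (λ x y → ∣ ν b gap (v zero) ∣² * x + digitColumn b (v zero) * y) (tailWeight-0 m) (tailWeight-0 (suc m)))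

  gradedWeight-gap-zero : v zero ≡ gap → gradedWeight (suc ℓ) B v 0 ≡ b * G 0
  gradedWeight-gap-zero eq =
    trans gradedWeight-suc-zero (cong (_* G 0) (trans (cong (digitColumn b) eq) (digitColumn-gap b)))

  gradedWeight-gap-suc : v zero ≡ gap → ∀ m → gradedWeight (suc ℓ) B v (suc m) ≡ b * b * G m + b * G (suc m)
  gradedWeight-gap-suc eq m =
    trans (gradedWeight-suc-suc m)
          (cong₂ (λ x z → x * G m + z * G (suc m))
                 (trans (cong (λ s → ∣ ν b gap s ∣²) eq) (cong (λ n → n * n) (∣-i∣≡∣i∣ (+ b))))
                 (trans (cong (digitColumn b) eq) (digitColumn-gap b)))

  gradedWeight-dig : ∀ {y} → v zero ≡ dig y → ∀ m → gradedWeight (suc ℓ) B v m ≡ (toℕ y + toℕ y * toℕ y) * G m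
  gradedWeight-dig {y} eq zero =
    trans gradedWeight-suc-zero (cong (_* G 0) (trans (cong (digitColumn b) eq) (digitColumn-dig b y)))
  gradedWeight-dig {y} eq (suc m) =
    trans (gradedWeight-suc-suc m)
          (cong₂ (λ x z → x * G m + z * G (suc m))
                 (cong (λ s → ∣ ν b gap s ∣²) eq)
                 (trans (cong (digitColumn b) eq) (digitColumn-dig b y)))

closedForm : ℕ → List ℕ → List ℕ → ℕ
closedForm m G N = esym m G * product N * product G

closedForm-dig : ∀ y m G N → y * closedForm m G N ≡ closedForm m G (y ∷ N)
closedForm-dig y m G N = identity y (esym m G) (product N) (product G)
  where
  identity : ∀ y e P Q → y * (e * P * Q) ≡ e * (y * P) * Q
  identity = solve-∀

closedForm-gap-zero : ∀ b G N → b * closedForm 0 G N ≡ closedForm 0 (b ∷ G) N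
closedForm-gap-zero b G N = identity b (product N) (product G)
  where
  identity : ∀ b P Q → b * (1 * P * Q) ≡ 1 * P * (b * Q)
  identity = solve-∀

closedForm-gap-suc : ∀ b m G N → b * b * closedForm m G N + b * closedForm (suc m) G N ≡ closedForm (suc m) (b ∷ G) N
closedForm-gap-suc b m G N = identity b (esym m G) (esym (suc m) G) (product N) (product G)
  where
  identity : ∀ b e e′ P Q → b * b * (e * P * Q) + b * (e′ * P * Q) ≡ (b * e + e′) * P * (b * Q)
  identity = solve-∀

gradedWeight≡closedForm : ∀ ℓ (B : Fin ℓ → ℕ) (v : Word ℓ B) m →
                          gradedWeight ℓ B v m ≡ closedForm m (gapBases v) (digitFactors v)
gradedWeight≡closedForm zero    B v zero    = refl
gradedWeight≡closedForm zero    B v (suc m) = refl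
gradedWeight≡closedForm (suc ℓ) B v = byHead (v zero) refl
  where
  IH = gradedWeight≡closedForm ℓ (B ∘ suc) (v ∘ suc)
  G′ = gapBases (v ∘ suc)
  N′ = digitFactors (v ∘ suc)
  b = B zero

  byHead : ∀ s → v zero ≡ s → ∀ m → gradedWeight (suc ℓ) B v m ≡ closedForm m (gapBases v) (digitFactors v)
  byHead (dig y) eq m = begin
    gradedWeight (suc ℓ) B v m                  ≡⟨ gradedWeight-dig B v eq m ⟩
    Y * gradedWeight ℓ (B ∘ suc) (v ∘ suc) m    ≡⟨ cong (Y *_) (IH m) ⟩
    Y * closedForm m G′ N′                      ≡⟨ closedForm-dig Y m G′ N′ ⟩
    closedForm m G′ (Y ∷ N′)                    ≡⟨ sym (cong₂ (closedForm m) (gapBases-dig v eq) (digitFactors-dig v eq)) ⟩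
    closedForm m (gapBases v) (digitFactors v)  ∎
    where Y = toℕ y + toℕ y * toℕ y
  byHead gap eq zero = begin
    gradedWeight (suc ℓ) B v 0                  ≡⟨ gradedWeight-gap-zero B v eq ⟩
    b * gradedWeight ℓ (B ∘ suc) (v ∘ suc) 0    ≡⟨ cong (b *_) (IH 0) ⟩
    b * closedForm 0 G′ N′                      ≡⟨ closedForm-gap-zero b G′ N′ ⟩
    closedForm 0 (b ∷ G′) N′                    ≡⟨ sym (cong₂ (closedForm 0) (gapBases-gap v eq) (digitFactors-gap v eq)) ⟩
    closedForm 0 (gapBases v) (digitFactors v)  ∎
  byHead gap eq (suc m) = begin
    gradedWeight (suc ℓ) B v (suc m)
      ≡⟨ gradedWeight-gap-suc B v eq m ⟩
    b * b * gradedWeight ℓ (B ∘ suc) (v ∘ suc) m + b * gradedWeight ℓ (B ∘ suc) (v ∘ suc) (suc m)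
      ≡⟨ cong₂ (λ x y → b * b * x + b * y) (IH m) (IH (suc m)) ⟩
    b * b * closedForm m G′ N′ + b * closedForm (suc m) G′ N′
      ≡⟨ closedForm-gap-suc b m G′ N′ ⟩
    closedForm (suc m) (b ∷ G′) N′
      ≡⟨ sym (cong₂ (closedForm (suc m)) (gapBases-gap v eq) (digitFactors-gap v eq)) ⟩
    closedForm (suc m) (gapBases v) (digitFactors v) ∎

proposition4 : (ℓ k : ℕ) → 1 ≤ ℓ → k ≤ ℓ → (B : Fin ℓ → ℕ) → (∀ i → 2 ≤ B i) →
    (v' : Word ℓ B) → (∀ i → isZeroDigit (v' i) ≡ false) →
    normSq ℓ k B v' ≡
      + (esym (ℓ ∸ k) (map B (gapSet v'))
         * prodℕ (map (λ i → val (v' i) + val (v' i) * val (v' i)) (nonGapSet v'))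
         * prodℕ (map B (gapSet v')))
proposition4 ℓ k _ _ B _ v' _ =
  trans (normSq≡gradedWeight ℓ k B v') (cong +_ (gradedWeight≡closedForm ℓ B v' (ℓ ∸ k)))
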